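{- For every complete $k$-partite graph $K_{r_1,\ldots,r_k}$ we have $\chi_g(K_{r_1,\ldots,r_k})\le 2k-1$.
   Context: Graph coloring game: given a graph $G$ and a finite set $C$ of colors, Alice and Bob alternately (Alice first) pick an uncolored vertex and give it a legal color, i.e. a color from $C$ not used on any neighbor. The game ends when all vertices are colored (Alice wins) or when no uncolored vertex has a legal color (Bob wins). The game chromatic number $\chi_g(G)$ is the minimum $|C|$ for which Alice has a winning strategy. $K_{r_1,\ldots,r_k}$ denotes the complete $k$-partite graph with parts (independent sets) $V_1,\ldots,V_k$, $|V_i|=r_i\ge1$, $r_1\ge\cdots\ge r_k$, every two vertices in different parts adjacent; the paper assumes that if $k\ge2$ then $r_1\ge 2$. -}

module Defs where

open import Data.Nat using (ℕ; _≤_)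
open import Data.Fin using (Fin)
open import Data.Maybe using (Maybe; just; nothing)
open import Data.Product using (Σ; ∃; ∃-syntax; _×_; _,_; proj₁)
open import Relation.Binary.PropositionalEquality using (_≡_; _≢_)

record Graph : Set₁ where
  field
    V   : Set
    Adj : V → V → Set
open Graph public

module Game (G : Graph) (c : ℕ) where
  Position : Set
  Position = V G → Maybe (Fin c)

  Complete : Position → Set
  Complete p = ∀ v → ∃[ a ] (p v ≡ just a)

  Legal : Position → V G → Fin c → Set
  Legal p v a = (p v ≡ nothing) × (∀ w → Adj G v w → p w ≢ just a)

  Update : Position → V G → Fin c → Position → Set
  Update p v a p' = (p' v ≡ just a) × (∀ w → w ≢ v → p' w ≡ p w)

  -- AliceTurn p : Alice (to move) has a winning strategy from p
  -- BobTurn p   : Alice has a winning strategy from p with Bob to move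
  data AliceTurn (p : Position) : Set
  data BobTurn (p : Position) : Set

  data AliceTurn p where
    done : Complete p → AliceTurn p
    move : (v : V G) (a : Fin c) → Legal p v a →
           (∀ p' → Update p v a p' → BobTurn p') → AliceTurn p

  data BobTurn p where
    done    : Complete p → BobTurn p
    respond : (∃[ v ] ∃[ a ] Legal p v a) →
              (∀ v a → Legal p v a → ∀ p' → Update p v a p' → AliceTurn p') →
              BobTurn p

  empty : Position
  empty _ = nothing

  AliceWins : Set
  AliceWins = AliceTurn empty

-- χ_g(G) ≤ m  (χ_g is the minimum number of colours for which Alice wins)
GameChromatic≤ : Graph → ℕ → Set
GameChromatic≤ G m = ∃[ c ] (c ≤ m × Game.AliceWins G c)

CompleteMultipartite : (k : ℕ) → (Fin k → ℕ) → Graph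
CompleteMultipartite k r = record
  { V   = Σ (Fin k) (λ i → Fin (r i))
  ; Adj = λ u w → proj₁ u ≢ proj₁ w
  }

{-# OPTIONS --safe #-}

-- Alice's strategy: while some part contains no coloured vertex, she colours a vertex of
-- such a part with a colour not used anywhere; once every part contains a coloured vertex,
-- she colours any uncoloured vertex with a colour already present in its part, which is
-- legal because colour classes never meet two parts.  After Alice has entered t parts,
-- at most 2t colours are in use before her move, since each of her moves adds one colour
-- and one entered part and each of Bob's moves adds at most one colour.  So while some
-- part is empty we have t < k and a fresh colour among 2k − 1 exists, for Bob as well;
-- hence neither player is ever stuck.

module Submission where

open import Defs
open import Algebra.Properties.Monoid.Sum using ()
open import Data.Nat using (ℕ; zero; suc; _≤_; _<_; _+_; _*_; _∸_; z≤n; s≤s; s≤s⁻¹)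
open import Data.Nat.Properties
  using (≤-refl; ≤-reflexive; ≤-trans; <-≤-trans; +-comm; +-suc; *-suc; m≤n+m;
         +-monoʳ-≤; +-mono-≤; +-mono-<-≤; +-mono-≤-<; *-monoʳ-≤; ∸-monoˡ-≤; +-0-monoid)
open import Data.Fin as F using (Fin; fromℕ<; toℕ)
open import Data.Fin.Properties using (any?; all?; ¬∀⟶∃¬) renaming (_≟_ to _≟ᶠ_)
open import Data.Fin.Subset
  using (Subset; Side; inside; outside; _∈_; _∉_; _⊆_; _∪_; ⁅_⁆; ∣_∣) renaming (⊥ to ∅)
open import Data.Fin.Subset.Properties
  using (∣p∣≤∣x∷p∣; ∣⊥∣≡0; ∉⊥; ∣⊤∣≡n; ⊆⊤; ∈⊤; x∈⁅x⁆; x∈⁅y⁆⇒x≡y; ∣⁅x⁆∣≡1; drop-there;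
         p⊆p∪q; x∈p∪q⁺; x∈p∪q⁻; p⊆q⇒∣p∣≤∣q∣; p⊂q⇒∣p∣<∣q∣)
open import Data.Maybe using (Maybe; just; nothing; is-nothing)
open import Data.Maybe.Properties using (just-injective)
open import Data.Product as Product using (∃; ∃-syntax; _,_; proj₁; proj₂)
open import Data.Product.Properties using (≡-dec)
open import Data.Sum as Sum using (_⊎_; inj₁; inj₂)
open import Data.Vec using ([]; _∷_; tabulate)
open import Data.Vec.Functional using (Vector)
open import Data.Vec.Properties using (lookup∘tabulate; lookup⇒[]=; []=⇒lookup)
open import Data.Empty using (⊥; ⊥-elim)
open import Function using (_∘_)
open import Relation.Binary.Definitions using (DecidableEquality)
open import Relation.Nullary using (Dec; yes; no; ¬_; ¬?)
open import Relation.Nullary.Decidable using (decidable-stable)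
open import Relation.Binary.PropositionalEquality
  using (_≡_; _≢_; refl; sym; trans; cong; subst)

open Algebra.Properties.Monoid.Sum +-0-monoid using (sum)
open Data.Nat.Properties.≤-Reasoning

∣p∪q∣≤∣p∣+∣q∣ : ∀ {n} (p q : Subset n) → ∣ p ∪ q ∣ ≤ ∣ p ∣ + ∣ q ∣
∣p∪q∣≤∣p∣+∣q∣ []            []            = z≤n
∣p∪q∣≤∣p∣+∣q∣ (outside ∷ p) (outside ∷ q) = ∣p∪q∣≤∣p∣+∣q∣ p q
∣p∪q∣≤∣p∣+∣q∣ (outside ∷ p) (inside  ∷ q) =
  ≤-trans (s≤s (∣p∪q∣≤∣p∣+∣q∣ p q)) (≤-reflexive (sym (+-suc ∣ p ∣ ∣ q ∣)))
∣p∪q∣≤∣p∣+∣q∣ (inside  ∷ p) (s       ∷ q) =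
  s≤s (≤-trans (∣p∪q∣≤∣p∣+∣q∣ p q) (+-monoʳ-≤ ∣ p ∣ (∣p∣≤∣x∷p∣ s q)))

∣p∪⁅x⁆∣≤1+∣p∣ : ∀ {n} (p : Subset n) x → ∣ p ∪ ⁅ x ⁆ ∣ ≤ suc ∣ p ∣
∣p∪⁅x⁆∣≤1+∣p∣ p x = ≤-trans (∣p∪q∣≤∣p∣+∣q∣ p ⁅ x ⁆)
  (≤-reflexive (trans (cong (∣ p ∣ +_) (∣⁅x⁆∣≡1 x)) (+-comm ∣ p ∣ 1)))

x∉p⇒∣p∣<∣p∪⁅x⁆∣ : ∀ {n} {p : Subset n} {x} → x ∉ p → ∣ p ∣ < ∣ p ∪ ⁅ x ⁆ ∣
x∉p⇒∣p∣<∣p∪⁅x⁆∣ {x = x} x∉p =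
  p⊂q⇒∣p∣<∣q∣ (p⊆p∪q ⁅ x ⁆ , x , x∈p∪q⁺ (inj₂ (x∈⁅x⁆ x)) , x∉p)

x∉p⇒∣p∣<n : ∀ {n} {p : Subset n} {x} → x ∉ p → ∣ p ∣ < n
x∉p⇒∣p∣<n {n} {p} {x} x∉p = subst (∣ p ∣ <_) (∣⊤∣≡n n) (p⊂q⇒∣p∣<∣q∣ (⊆⊤ , x , ∈⊤ , x∉p))

∣p∣<n⇒∃x∉p : ∀ {n} (p : Subset n) → ∣ p ∣ < n → ∃ (_∉ p)
∣p∣<n⇒∃x∉p (outside ∷ p) _     = F.zero , λ ()
∣p∣<n⇒∃x∉p (inside  ∷ p) ∣p∣<n =
  Product.map F.suc (_∘ drop-there) (∣p∣<n⇒∃x∉p p (s≤s⁻¹ ∣p∣<n))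

∈-tabulate⁺ : ∀ {n} {f : Fin n → Side} {x} → f x ≡ inside → x ∈ tabulate f
∈-tabulate⁺ {f = f} {x} fx = lookup⇒[]= x (tabulate f) (trans (lookup∘tabulate f x) fx)

∈-tabulate⁻ : ∀ {n} {f : Fin n → Side} {x} → x ∈ tabulate f → f x ≡ inside
∈-tabulate⁻ {f = f} {x} x∈ = trans (sym (lookup∘tabulate f x)) ([]=⇒lookup x∈)

sum-mono-≤ : ∀ {n} {f g : Vector ℕ n} → (∀ i → f i ≤ g i) → sum f ≤ sum g
sum-mono-≤ {zero}  f≤g = z≤n
sum-mono-≤ {suc n} f≤g = +-mono-≤ (f≤g F.zero) (sum-mono-≤ (f≤g ∘ F.suc))

sum-mono-< : ∀ {n} {f g : Vector ℕ n} → (∀ i → f i ≤ g i) → ∀ i → f i < g i → sum f < sum g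
sum-mono-< f≤g F.zero    fi<gi = +-mono-<-≤ fi<gi (sum-mono-≤ (f≤g ∘ F.suc))
sum-mono-< f≤g (F.suc i) fi<gi = +-mono-≤-< (f≤g F.zero) (sum-mono-< (f≤g ∘ F.suc) i fi<gi)

2+2*m≤2*n : ∀ {m n} → m < n → 2 + 2 * m ≤ 2 * n
2+2*m≤2*n {m} m<n = ≤-trans (≤-reflexive (sym (*-suc 2 m))) (*-monoʳ-≤ 2 m<n)

≤2*m⇒<2*n∸1 : ∀ {u m n} → u ≤ 2 * m → m < n → u < 2 * n ∸ 1
≤2*m⇒<2*n∸1 u≤2m m<n = ∸-monoˡ-≤ 1 (≤-trans (s≤s (s≤s u≤2m)) (2+2*m≤2*n m<n))

≢just⇒≡nothing : ∀ {A : Set} {m : Maybe A} → ¬ (∃[ a ] m ≡ just a) → m ≡ nothing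
≢just⇒≡nothing {m = nothing} _      = refl
≢just⇒≡nothing {m = just a}  ≢just = ⊥-elim (≢just (a , refl))

module Moves (G : Graph) (c : ℕ) (_≟_ : DecidableEquality (V G))
             (Adj-sym : ∀ {v w} → Adj G v w → Adj G w v)
             (Adj-irrefl : ∀ {v} → ¬ Adj G v v) where
  open Game G c

  Coloured : Position → V G → Set
  Coloured p v = ∃[ a ] p v ≡ just a

  coloured? : ∀ p v → Dec (Coloured p v)
  coloured? p v with p v
  ... | just a  = yes (a , refl)
  ... | nothing = no λ { (_ , ()) }

  Proper : Position → Set
  Proper p = ∀ {v w a} → Adj G v w → p v ≡ just a → p w ≡ just a → ⊥

  record Move (p p' : Position) : Set where
    constructor mkMove
    field
      vertex : V G
      colour : Fin c
      legal  : Legal p vertex colour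
      update : Update p vertex colour p'

  module _ {p p'} (m : Move p p') where
    open Move m renaming (vertex to v; colour to a)

    private
      before : ∀ {w b} → w ≢ v → p' w ≡ just b → p w ≡ just b
      before w≢v p'w = trans (sym (proj₂ update _ w≢v)) p'w

      new-colour : ∀ {b} → p' v ≡ just b → b ≡ a
      new-colour p'v = just-injective (trans (sym p'v) (proj₁ update))

    colour-preserved : ∀ {w b} → p w ≡ just b → p' w ≡ just b
    colour-preserved {w} pw = trans (proj₂ update w w≢v) pw
      where
      w≢v : w ≢ v
      w≢v refl with trans (sym (proj₁ legal)) pw
      ... | ()

    coloured-preserved : ∀ {w} → Coloured p w → Coloured p' w
    coloured-preserved (b , pw) = b , colour-preserved pw

    uncoloured-before : ∀ {w} → p' w ≡ nothing → p w ≡ nothing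
    uncoloured-before {w} p'w with p w in pw
    ... | nothing = refl
    ... | just b with trans (sym p'w) (colour-preserved pw)
    ...   | ()

    colour-origin : ∀ {w b} → p' w ≡ just b → p w ≡ just b ⊎ b ≡ a
    colour-origin {w} p'w with w ≟ v
    ... | yes refl = inj₂ (new-colour p'w)
    ... | no w≢v   = inj₁ (before w≢v p'w)

    proper-preserved : Proper p → Proper p'
    proper-preserved proper {x} {y} xy p'x p'y with x ≟ v | y ≟ v
    ... | yes refl | yes refl = Adj-irrefl xy
    ... | yes refl | no y≢v   =
      proj₂ legal y xy (subst (λ b → p y ≡ just b) (new-colour p'x) (before y≢v p'y))
    ... | no x≢v   | yes refl =
      proj₂ legal x (Adj-sym xy) (subst (λ b → p x ≡ just b) (new-colour p'y) (before x≢v p'x))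
    ... | no x≢v   | no y≢v   = proper xy (before x≢v p'x) (before y≢v p'y)

module MultipartiteStrategy (k : ℕ) (r : Fin k → ℕ) (nonempty : ∀ i → 1 ≤ r i)
                            (c : ℕ) (enough : 2 * k ∸ 1 ≤ c) where
  open Game (CompleteMultipartite k r) c
  open Moves (CompleteMultipartite k r) c (≡-dec _≟ᶠ_ _≟ᶠ_) (λ i≢j → i≢j ∘ sym) (λ i≢i → i≢i refl)

  Touched : Position → Fin k → Set
  Touched p i = ∃[ j ] Coloured p (i , j)

  touched? : ∀ p i → Dec (Touched p i)
  touched? p i = any? λ j → coloured? p (i , j)

  complete⊎uncoloured : ∀ p → Complete p ⊎ ∃ λ v → p v ≡ nothing
  complete⊎uncoloured p with any? (λ i → any? λ j → ¬? (coloured? p (i , j)))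
  ... | yes (i , j , uncoloured) = inj₂ ((i , j) , ≢just⇒≡nothing uncoloured)
  ... | no none = inj₁ λ (i , j) →
    decidable-stable (coloured? p (i , j)) λ uncoloured → none (i , j , uncoloured)

  uncolouredIn : Position → (i : Fin k) → Subset (r i)
  uncolouredIn p i = tabulate λ j → is-nothing (p (i , j))

  uncoloured : Position → ℕ
  uncoloured p = sum λ i → ∣ uncolouredIn p i ∣

  ∈-uncolouredIn⁺ : ∀ p i {j} → p (i , j) ≡ nothing → j ∈ uncolouredIn p i
  ∈-uncolouredIn⁺ p i pv = ∈-tabulate⁺ (cong is-nothing pv)

  ∈-uncolouredIn⁻ : ∀ p i {j} → j ∈ uncolouredIn p i → p (i , j) ≡ nothing
  ∈-uncolouredIn⁻ p i {j} j∈ with p (i , j) | ∈-tabulate⁻ j∈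
  ... | nothing | _  = refl
  ... | just _  | ()

  uncoloured-decreases : ∀ {p p'} → Move p p' → uncoloured p' < uncoloured p
  uncoloured-decreases {p} {p'} m@(mkMove (i , j) _ legal update) =
    sum-mono-< (λ _ → p⊆q⇒∣p∣≤∣q∣ shrinks) i
      (p⊂q⇒∣p∣<∣q∣ (shrinks , j , ∈-uncolouredIn⁺ p i (proj₁ legal) , j∉))
    where
    shrinks : ∀ {i} → uncolouredIn p' i ⊆ uncolouredIn p i
    shrinks {i} = ∈-uncolouredIn⁺ p i ∘ uncoloured-before m ∘ ∈-uncolouredIn⁻ p' i
    j∉ : j ∉ uncolouredIn p' i
    j∉ j∈ with trans (sym (∈-uncolouredIn⁻ p' i j∈)) (proj₁ update)
    ... | ()

  AllTouched : Position → Set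
  AllTouched p = ∀ i → Touched p i

  -- parts and colours are bookkeeping carried along by the strategy, not read off the position;
  -- the slack is 0 before Alice's moves and 1 before Bob's.
  record Invariant (slack : ℕ) (p : Position) : Set where
    field
      proper  : Proper p
      parts   : Subset k
      colours : Subset c
      entered : ∀ {i} → i ∈ parts → Touched p i
      covered : ∀ {v a} → p v ≡ just a → a ∈ colours
      budget  : AllTouched p ⊎ slack + ∣ colours ∣ ≤ 2 * ∣ parts ∣
  open Invariant

  initial : Invariant 0 empty
  initial = record
    { proper  = λ _ ()
    ; parts   = ∅
    ; colours = ∅
    ; entered = ⊥-elim ∘ ∉⊥
    ; covered = λ ()
    ; budget  = inj₂ (≤-trans (≤-reflexive (∣⊥∣≡0 c)) z≤n)
    }

  unused-colour : ∀ {s p i} (inv : Invariant s p) → ¬ Touched p i → ∃ (_∉ colours inv)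
  unused-colour {s} {i = i} inv untouched with budget inv
  ... | inj₁ allTouched = ⊥-elim (untouched (allTouched i))
  ... | inj₂ s+u≤2t     = ∣p∣<n⇒∃x∉p (colours inv)
    (≤-trans (≤2*m⇒<2*n∸1 (≤-trans (m≤n+m _ s) s+u≤2t) (x∉p⇒∣p∣<n (untouched ∘ entered inv))) enough)

  unused-legal : ∀ {s p v a} (inv : Invariant s p) → a ∉ colours inv → p v ≡ nothing → Legal p v a
  unused-legal inv a∉ pv = pv , λ _ _ pw → a∉ (covered inv pw)

  copy-legal : ∀ {p i j j′ a} → Proper p → p (i , j′) ≡ just a → p (i , j) ≡ nothing → Legal p (i , j) a
  copy-legal proper pj′ pj = pj , λ _ i≢ pw → proper i≢ pj′ pw

  module _ {p p'} (m : Move p p') where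
    open Move m using (colour)

    touched-preserved : ∀ {i} → Touched p i → Touched p' i
    touched-preserved (j , coloured) = j , coloured-preserved m coloured

    allTouched-preserved : AllTouched p → AllTouched p'
    allTouched-preserved allTouched i = touched-preserved (allTouched i)

    module _ {s} (inv : Invariant s p) where

      colours-covered : ∀ {w b} → p' w ≡ just b → b ∈ colours inv ∪ ⁅ colour ⁆
      colours-covered p'w with colour-origin m p'w
      ... | inj₁ pw   = x∈p∪q⁺ (inj₁ (covered inv pw))
      ... | inj₂ refl = x∈p∪q⁺ (inj₂ (x∈⁅x⁆ colour))

      invariant-after : ∀ {s'} (parts' : Subset k) → (∀ {i} → i ∈ parts' → Touched p' i) →
                        AllTouched p' ⊎ s' + ∣ colours inv ∪ ⁅ colour ⁆ ∣ ≤ 2 * ∣ parts' ∣ →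
                        Invariant s' p'
      invariant-after parts' entered' budget' = record
        { proper  = proper-preserved m (proper inv)
        ; parts   = parts'
        ; colours = colours inv ∪ ⁅ colour ⁆
        ; entered = entered'
        ; covered = colours-covered
        ; budget  = budget'
        }

  after-bob : ∀ {p p'} → Invariant 1 p → Move p p' → Invariant 0 p'
  after-bob inv m = invariant-after m inv (parts inv) (touched-preserved m ∘ entered inv)
    (Sum.map (allTouched-preserved m) (≤-trans (∣p∪⁅x⁆∣≤1+∣p∣ (colours inv) (Move.colour m))) (budget inv))

  after-copy : ∀ {p p'} → Invariant 0 p → AllTouched p → Move p p' → Invariant 1 p'
  after-copy inv allTouched m =
    invariant-after m inv (parts inv) (touched-preserved m ∘ entered inv) (inj₁ (allTouched-preserved m allTouched))

  after-fresh : ∀ {p p'} → Invariant 0 p → (m : Move p p') →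
                ¬ Touched p (proj₁ (Move.vertex m)) → Invariant 1 p'
  after-fresh {p' = p'} inv m@(mkMove (i , j) a _ update) untouched with budget inv
  ... | inj₁ allTouched = ⊥-elim (untouched (allTouched i))
  ... | inj₂ u≤2t       = invariant-after m inv (parts inv ∪ ⁅ i ⁆) entered'
    (inj₂ (begin
      suc ∣ colours inv ∪ ⁅ a ⁆ ∣ ≤⟨ s≤s (∣p∪⁅x⁆∣≤1+∣p∣ (colours inv) a) ⟩
      2 + ∣ colours inv ∣         ≤⟨ +-monoʳ-≤ 2 u≤2t ⟩
      2 + 2 * ∣ parts inv ∣       ≤⟨ 2+2*m≤2*n (x∉p⇒∣p∣<∣p∪⁅x⁆∣ (untouched ∘ entered inv)) ⟩
      2 * ∣ parts inv ∪ ⁅ i ⁆ ∣   ∎))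
    where
    entered' : ∀ {i'} → i' ∈ parts inv ∪ ⁅ i ⁆ → Touched p' i'
    entered' i'∈ with x∈p∪q⁻ (parts inv) ⁅ i ⁆ i'∈
    ... | inj₁ i'∈parts = touched-preserved m (entered inv i'∈parts)
    ... | inj₂ i'∈⁅i⁆ rewrite x∈⁅y⁆⇒x≡y i i'∈⁅i⁆ = j , a , proj₁ update

  fuel-after : ∀ {n p p'} → uncoloured p < suc n → Move p p' → uncoloured p' < n
  fuel-after fuel m = <-≤-trans (uncoloured-decreases m) (s≤s⁻¹ fuel)

  mutual
    alice : ∀ n {p} → uncoloured p < n → Invariant 0 p → AliceTurn p
    alice zero    ()   _
    alice (suc n) {p} fuel inv with complete⊎uncoloured p | all? (touched? p)
    ... | inj₁ complete         | _ = done complete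
    ... | inj₂ ((i , j) , free) | yes allTouched with allTouched i
    ...   | j′ , a , pj′ = move (i , j) a legal λ p' update →
      let m = mkMove (i , j) a legal update in bob n (fuel-after fuel m) (after-copy inv allTouched m)
      where
      legal = copy-legal (proper inv) pj′ free
    alice (suc n) {p} fuel inv | inj₂ _ | no notAllTouched
      with ¬∀⟶∃¬ k (Touched p) (touched? p) notAllTouched
    ... | i , untouched with unused-colour inv untouched
    ...   | a , a∉ = move (i , j₀) a legal λ p' update →
      let m = mkMove (i , j₀) a legal update in bob n (fuel-after fuel m) (after-fresh inv m untouched)
      where
      j₀ = fromℕ< (nonempty i)
      legal = unused-legal inv a∉ (≢just⇒≡nothing λ coloured → untouched (j₀ , coloured))

    bob : ∀ n {p} → uncoloured p < n → Invariant 1 p → BobTurn p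
    bob zero    ()   _
    bob (suc n) {p} fuel inv with complete⊎uncoloured p
    ... | inj₁ complete = done complete
    ... | inj₂ ((i , j) , free) = respond legalMove λ v a legal p' update →
      let m = mkMove v a legal update in alice n (fuel-after fuel m) (after-bob inv m)
      where
      legalMove : ∃[ v ] ∃[ a ] Legal p v a
      legalMove with touched? p i
      ... | yes (j′ , a , pj′) = (i , j) , a , copy-legal (proper inv) pj′ free
      ... | no untouched       =
        let a , a∉ = unused-colour inv untouched in (i , j) , a , unused-legal inv a∉ free

  alice-wins : AliceWins
  alice-wins = alice (suc (uncoloured empty)) ≤-refl initial

corollary1 : (k : ℕ) (r : Fin k → ℕ) →
    (∀ i → 1 ≤ r i) →
    (∀ i j → i F.≤ j → r j ≤ r i) →
    (2 ≤ k → ∀ i → toℕ i ≡ 0 → 2 ≤ r i) →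
    GameChromatic≤ (CompleteMultipartite k r) (2 * k ∸ 1)
corollary1 k r nonempty _ _ = 2 * k ∸ 1 , ≤-refl , alice-wins
  where open MultipartiteStrategy k r nonempty (2 * k ∸ 1) ≤-refl
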